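{- Let $\Psi$ be a fan-in $2$ noncommutative arithmetic circuit computing $\mathrm{Pal}_{n,n}(X,Y)$, with $\mathcal{M}_k$, $\mathcal{Q}$ as in the context. If $v=p_1p_2\cdots p_r\,q$ is a valid parameterization with $r>n$, then $\pi_n(v)=0$.
   Context: Let $\mathbb{F}$ be a field, $X=\{x_1,\dots,x_n\}$, $Y=\{y_1,\dots,y_n\}$ disjoint sets of noncommuting variables, and $\mathrm{Pal}_{n,n}(X,Y)=\sum_{(i_1,\dots,i_n)\in[n]^n} x_{i_1}\cdots x_{i_n}\,y_{i_n}\cdots y_{i_1}$. A fan-in $2$ noncommutative arithmetic circuit is a DAG whose leaves are labeled by field constants or variables, whose internal nodes (gates) are labeled $+$ or $\times$, each of in-degree exactly $2$, with designated left/right children at $\times$ gates; edges may carry field-constant weights scaling the polynomial along the edge. For a gate $g$, $\widehat g$ denotes the polynomial it computes. The syntactic degree $d(g)$: variable leaves have degree $1$, constant leaves degree $0$, $+$ gates take the maximum of children's degrees, $\times$ gates the sum. Let $l_1<\cdots<l_{d'}$ be the distinct syntactic degrees appearing in $\Psi$; for $k\in[d']$ let $P_k$ be the set of $\times$ gates $g$ with $d(g)=l_k$. For a gate $g$, $\widehat g_X\in\mathbb{F}\langle X\rangle$ is the sum of all non-constant monomials of $\widehat g$ involving only $X$-variables. Let $\mathcal{M}_k=\{\widehat a_X : \text{there is a }\times\text{ gate } g\in P_k \text{ with left child } a\}$. Let $\mathcal{Q}=\{1,x_1,\dots,x_n\}\cup\{\widehat g_X\mid g\text{ a }\times\text{ gate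 of }\Psi\}$. A valid parameterization is an expression $v=p_1p_2\cdots p_r\,q$ with $r\ge0$, $q\in\mathcal{Q}$, each $p_i\in\mathcal{M}_{m_i}$, and $d'\ge m_1>m_2>\cdots>m_r\ge1$. The map $\pi_n:\mathbb{F}\langle X\rangle\to\mathbb{F}\langle X\rangle$ is the linear projection onto the homogeneous degree-$n$ component. -}

module Defs where

open import Level using (Level; _⊔_; suc)
open import Algebra.Bundles using (CommutativeRing)
open import Data.Nat as ℕ using (ℕ; zero) renaming (suc to sucℕ; _<_ to _<ℕ_; _>_ to _>ℕ_)
open import Data.Fin as Fin using (Fin)
open import Data.Sum using (_⊎_; inj₁; inj₂)
open import Data.Sum.Properties using () renaming (≡-dec to ⊎-≡-dec)
open import Data.Product using (Σ; _×_; _,_; ∃; ∃-syntax)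
open import Data.List as List using (List; []; _∷_; _++_; map; reverse; concatMap; length; filter)
open import Data.List.Properties using () renaming (≡-dec to List-≡-dec)
open import Data.Bool using (Bool; true; false; _∧_; if_then_else_)
open import Relation.Binary.PropositionalEquality using (_≡_)
open import Relation.Nullary using (¬_; Dec; yes; no)
open import Relation.Nullary.Decidable using (⌊_⌋)

record Field (c ℓ : Level) : Set (suc (c ⊔ ℓ)) where
  field
    commutativeRing : CommutativeRing c ℓ
  open CommutativeRing commutativeRing public
  field
    0≉1     : ¬ (0# ≈ 1#)
    inverse : ∀ x → ¬ (x ≈ 0#) → ∃[ y ] (x * y ≈ 1#)

-- Noncommutative polynomials over a field F in the variables
-- X ⊎ Y = {x_1..x_n} ⊎ {y_1..y_n}  (x_i = inj₁ i, y_i = inj₂ i).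
-- A polynomial is a finite formal sum of (coefficient, monomial) pairs;
-- a monomial is a word over the variables.

module NCPoly {c ℓ} (F : Field c ℓ) (n : ℕ) where
  open Field F

  Var : Set
  Var = Fin n ⊎ Fin n

  Word : Set
  Word = List Var

  _≟w_ : (u w : Word) → Dec (u ≡ w)
  _≟w_ = List-≡-dec (⊎-≡-dec Fin._≟_ Fin._≟_)

  Poly : Set c
  Poly = List (Carrier × Word)

  coeff : Poly → Word → Carrier
  coeff []             w = 0#
  coeff ((a , u) ∷ p)  w with u ≟w w
  ... | yes _ = a + coeff p w
  ... | no  _ = coeff p w

  _≋_ : Poly → Poly → Set ℓ
  p ≋ q = ∀ w → coeff p w ≈ coeff q w

  𝟘 : Poly
  𝟘 = []

  𝟙 : Poly
  𝟙 = (1# , []) ∷ []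

  constP : Carrier → Poly
  constP a = (a , []) ∷ []

  varP : Var → Poly
  varP v = (1# , v ∷ []) ∷ []

  _⊕_ : Poly → Poly → Poly
  p ⊕ q = p ++ q

  _·_ : Carrier → Poly → Poly
  a · p = map (λ { (b , u) → (a * b , u) }) p

  _⊗_ : Poly → Poly → Poly
  p ⊗ q = concatMap (λ { (a , u) → map (λ { (b , w) → (a * b , u ++ w) }) q }) p

  prodP : List Poly → Poly
  prodP []       = 𝟙
  prodP (p ∷ ps) = p ⊗ prodP ps

  isXVar : Var → Bool
  isXVar (inj₁ _) = true
  isXVar (inj₂ _) = false

  allX : Word → Bool
  allX []       = true
  allX (v ∷ w)  = isXVar v ∧ allX w

  isNonConstX : Word → Bool
  isNonConstX []      = false
  isNonConstX (v ∷ w) = allX (v ∷ w)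

  xPart : Poly → Poly
  xPart []             = []
  xPart ((a , u) ∷ p)  = if isNonConstX u then (a , u) ∷ xPart p else xPart p

  π : ℕ → Poly → Poly
  π k []            = []
  π k ((a , u) ∷ p) = if ⌊ length u ℕ.≟ k ⌋ then (a , u) ∷ π k p else π k p

  -- Pal_{n,n}(X,Y) = Σ_{(i_1..i_n) ∈ [n]^n} x_{i_1}⋯x_{i_n} y_{i_n}⋯y_{i_1}
  tuples : ℕ → List (List (Fin n))
  tuples zero       = [] ∷ []
  tuples (sucℕ k)   = concatMap (λ i → map (i ∷_) (tuples k)) (List.allFin n)

  Pal : Poly
  Pal = map (λ is → (1# , map inj₁ is ++ reverse (map inj₂ is))) (tuples n)

  -- A circuit with m nodes is built by adding nodes one at a time; a node
  -- added to a circuit with m nodes may refer to any of those m earlier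
  -- nodes (index zero = most recently added node).  This represents an
  -- arbitrary DAG (in topological order), with sharing.

  data Node (m : ℕ) : Set c where
    varL   : Var → Node m
    constL : Carrier → Node m
    plusG  : (wl : Carrier) (l : Fin m) (wr : Carrier) (r : Fin m) → Node m
    timesG : (wl : Carrier) (l : Fin m) (wr : Carrier) (r : Fin m) → Node m

  data Circuit : ℕ → Set c where
    []  : Circuit 0
    _▷_ : ∀ {m} → Circuit m → Node m → Circuit (sucℕ m)

  node : ∀ {m} → Circuit m → Fin m → Σ ℕ Node
  node (C ▷ nd) Fin.zero    = _ , nd
  node (C ▷ nd) (Fin.suc i) = node C i

  eval : ∀ {m} → Circuit m → Fin m → Poly
  evalNode : ∀ {m} → Circuit m → Node m → Poly
  eval (C ▷ nd) Fin.zero    = evalNode C nd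
  eval (C ▷ nd) (Fin.suc i) = eval C i
  evalNode C (varL v)           = varP v
  evalNode C (constL a)         = constP a
  evalNode C (plusG  a l b r)   = (a · eval C l) ⊕ (b · eval C r)
  evalNode C (timesG a l b r)   = (a · eval C l) ⊗ (b · eval C r)

  deg : ∀ {m} → Circuit m → Fin m → ℕ
  degNode : ∀ {m} → Circuit m → Node m → ℕ
  deg (C ▷ nd) Fin.zero    = degNode C nd
  deg (C ▷ nd) (Fin.suc i) = deg C i
  degNode C (varL v)         = 1
  degNode C (constL a)       = 0
  degNode C (plusG  _ l _ r) = deg C l ℕ.⊔ deg C r
  degNode C (timesG _ l _ r) = deg C l ℕ.+ deg C r

  data LeftOf : ∀ {m} → Circuit m → Fin m → Poly → Set c where
    here  : ∀ {m} {C : Circuit m} {wl l wr r} →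
            LeftOf (C ▷ timesG wl l wr r) Fin.zero (eval C l)
    there : ∀ {m} {C : Circuit m} {nd : Node m} {g P} →
            LeftOf C g P → LeftOf (C ▷ nd) (Fin.suc g) P

  IsTimes : ∀ {m} → Circuit m → Fin m → Set c
  IsTimes C g = ∃[ P ] LeftOf C g P

  -- p ∈ M(ℓ): p = \hat a_X for a × gate g with d(g) = ℓ and left child a.
  -- (M_k of the paper is M(l_k), where l_k is the k-th smallest syntactic
  --  degree occurring in the circuit.)
  InM : ∀ {m} → Circuit m → ℕ → Poly → Set (c ⊔ ℓ)
  InM C d p = ∃[ g ] ∃[ P ] (LeftOf C g P × deg C g ≡ d × p ≋ xPart P)

  data InQ {m} (C : Circuit m) (q : Poly) : Set (c ⊔ ℓ) where
    q-one   : q ≋ 𝟙 → InQ C q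
    q-var   : (i : Fin n) → q ≋ varP (inj₁ i) → InQ C q
    q-gate  : (g : Fin m) → IsTimes C g → q ≋ xPart (eval C g) → InQ C q

-- Every element of a set M_k is the X-part of a polynomial, hence has no constant term,
-- i.e. has order at least 1 (order = least degree of a monomial with nonzero coefficient).
-- Order is superadditive under multiplication (proved letter by letter, using the Leibniz
-- rule for the left derivative ∂ x, which deletes a leading x), so p₁⋯p_r q has order at
-- least r > n and its homogeneous degree-n component vanishes.
module Submission where

open import Defs
open import Data.Nat using (ℕ; suc; _>_)
open import Data.Fin using (Fin; zero)
open import Data.Product using (_×_; proj₁; proj₂)
open import Data.List using (List; map; length)
open import Data.List.Relation.Unary.All using (All)
open import Data.List.Relation.Unary.Linked using (Linked)

import Data.Nat as ℕ
open import Data.Nat using (_<_; _≤_; z≤n; s≤s)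
import Data.Nat.Properties as ℕₚ
import Data.Fin as Fin
open import Data.Product using (_,_)
open import Data.Sum.Properties using () renaming (≡-dec to ⊎-≡-dec)
open import Data.List using ([]; _∷_; _++_)
open import Data.List.Properties using (∷-injective; ++-identityʳ; length-map)
import Data.List.Relation.Unary.All as All
import Data.List.Relation.Unary.All.Properties as All
open import Data.Bool using (true; false; _∧_)
open import Data.Empty using (⊥-elim)
open import Relation.Nullary using (Dec; yes; no; ¬_)
import Relation.Binary.PropositionalEquality as ≡
open import Relation.Binary.PropositionalEquality using (_≡_)
import Relation.Binary.Reasoning.Setoid as SetoidReasoning

module PolynomialOrder {c ℓ} (F : Field c ℓ) (n : ℕ) where
  open Field F
  open NCPoly F n
  open SetoidReasoning setoid
  open import Algebra.Properties.CommutativeSemigroup +-commutativeSemigroup using (x∙yz≈y∙xz)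

  _≟v_ : (x y : Var) → Dec (x ≡ y)
  _≟v_ = ⊎-≡-dec Fin._≟_ Fin._≟_

  monoP : Carrier → Word → Poly
  monoP a u = (a , u) ∷ []

  OrderAtLeast : ℕ → Poly → Set ℓ
  OrderAtLeast k p = ∀ w → length w < k → coeff p w ≈ 0#

  order-weaken : ∀ {a b} p → b ≤ a → OrderAtLeast a p → OrderAtLeast b p
  order-weaken p b≤a ord w lt = ord w (ℕₚ.<-≤-trans lt b≤a)

  coeff-⊕ : ∀ p q w → coeff (p ⊕ q) w ≈ coeff p w + coeff q w
  coeff-⊕ []            q w = sym (+-identityˡ _)
  coeff-⊕ ((a , u) ∷ p) q w with u ≟w w
  ... | yes _ = trans (+-cong refl (coeff-⊕ p q w)) (sym (+-assoc _ _ _))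
  ... | no  _ = coeff-⊕ p q w

  coeff-∷-⊗ : ∀ a u p q w →
    coeff (((a , u) ∷ p) ⊗ q) w ≈ coeff (monoP a u ⊗ q) w + coeff (p ⊗ q) w
  coeff-∷-⊗ a u p q w = trans (coeff-⊕ (map _ q) (p ⊗ q) w)
    (+-cong (reflexive (≡.cong (λ r → coeff r w) (≡.sym (++-identityʳ (map _ q))))) refl)

  coeff-const-⊗ : ∀ a q w → coeff (monoP a [] ⊗ q) w ≈ a * coeff q w
  coeff-const-⊗ a []            w = sym (zeroʳ a)
  coeff-const-⊗ a ((b , v) ∷ q) w with v ≟w w
  ... | yes _ = trans (+-cong refl (coeff-const-⊗ a q w)) (sym (distribˡ a b _))
  ... | no  _ = coeff-const-⊗ a q w

  coeff-letter-⊗-[] : ∀ a y u q → coeff (monoP a (y ∷ u) ⊗ q) [] ≈ 0#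
  coeff-letter-⊗-[] a y u []            = refl
  coeff-letter-⊗-[] a y u ((b , v) ∷ q) = coeff-letter-⊗-[] a y u q

  coeff-letter-⊗-≡ : ∀ a y u q x w → y ≡ x →
    coeff (monoP a (y ∷ u) ⊗ q) (x ∷ w) ≈ coeff (monoP a u ⊗ q) w
  coeff-letter-⊗-≡ a y u []            x w y≡x = refl
  coeff-letter-⊗-≡ a y u ((b , v) ∷ q) x w y≡x with (u ++ v) ≟w w | y ≟v x
  ... | _     | no y≢x = ⊥-elim (y≢x y≡x)
  ... | yes _ | yes _  = +-cong refl (coeff-letter-⊗-≡ a y u q x w y≡x)
  ... | no  _ | yes _  = coeff-letter-⊗-≡ a y u q x w y≡x

  coeff-letter-⊗-≢ : ∀ a y u q x w → ¬ y ≡ x → coeff (monoP a (y ∷ u) ⊗ q) (x ∷ w) ≈ 0#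
  coeff-letter-⊗-≢ a y u []            x w y≢x = refl
  coeff-letter-⊗-≢ a y u ((b , v) ∷ q) x w y≢x with y ≟v x
  ... | yes y≡x = ⊥-elim (y≢x y≡x)
  ... | no  _   = coeff-letter-⊗-≢ a y u q x w y≢x

  ∂ : Var → Poly → Poly
  ∂ x []                 = []
  ∂ x ((a , [])    ∷ p) = ∂ x p
  ∂ x ((a , y ∷ u) ∷ p) with y ≟v x
  ... | yes _ = (a , u) ∷ ∂ x p
  ... | no  _ = ∂ x p

  coeff-∂ : ∀ x p w → coeff (∂ x p) w ≈ coeff p (x ∷ w)
  coeff-∂ x []                 w = refl
  coeff-∂ x ((a , [])    ∷ p) w = coeff-∂ x p w
  coeff-∂ x ((a , y ∷ u) ∷ p) w with y ≟v x
  coeff-∂ x ((a , y ∷ u) ∷ p) w | yes y≡x with u ≟w w | (y ∷ u) ≟w (x ∷ w)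
  ... | yes _   | yes _ = +-cong refl (coeff-∂ x p w)
  ... | no  _   | no  _ = coeff-∂ x p w
  ... | yes u≡w | no ne = ⊥-elim (ne (≡.cong₂ _∷_ y≡x u≡w))
  ... | no  u≢w | yes e = ⊥-elim (u≢w (proj₂ (∷-injective e)))
  coeff-∂ x ((a , y ∷ u) ∷ p) w | no y≢x with (y ∷ u) ≟w (x ∷ w)
  ... | yes e = ⊥-elim (y≢x (proj₁ (∷-injective e)))
  ... | no  _ = coeff-∂ x p w

  coeff-⊗-[] : ∀ p q → coeff (p ⊗ q) [] ≈ coeff p [] * coeff q []
  coeff-⊗-[] []                 q = sym (zeroˡ _)
  coeff-⊗-[] ((a , [])    ∷ p) q = begin
    coeff (((a , []) ∷ p) ⊗ q) []                 ≈⟨ coeff-∷-⊗ a [] p q [] ⟩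
    coeff (monoP a [] ⊗ q) [] + coeff (p ⊗ q) []  ≈⟨ +-cong (coeff-const-⊗ a q []) (coeff-⊗-[] p q) ⟩
    a * coeff q [] + coeff p [] * coeff q []      ≈⟨ distribʳ _ a _ ⟨
    (a + coeff p []) * coeff q []                 ∎
  coeff-⊗-[] ((a , y ∷ u) ∷ p) q = begin
    coeff (((a , y ∷ u) ∷ p) ⊗ q) []                   ≈⟨ coeff-∷-⊗ a (y ∷ u) p q [] ⟩
    coeff (monoP a (y ∷ u) ⊗ q) [] + coeff (p ⊗ q) []  ≈⟨ +-cong (coeff-letter-⊗-[] a y u q) (coeff-⊗-[] p q) ⟩
    0# + coeff p [] * coeff q []                       ≈⟨ +-identityˡ _ ⟩
    coeff p [] * coeff q []                            ∎

  coeff-⊗-∷ : ∀ p q x w →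
    coeff (p ⊗ q) (x ∷ w) ≈ coeff (∂ x p ⊗ q) w + coeff p [] * coeff q (x ∷ w)
  coeff-⊗-∷ []                 q x w = sym (trans (+-identityˡ _) (zeroˡ _))
  coeff-⊗-∷ ((a , [])    ∷ p) q x w = begin
    coeff (((a , []) ∷ p) ⊗ q) (x ∷ w)                        ≈⟨ coeff-∷-⊗ a [] p q (x ∷ w) ⟩
    coeff (monoP a [] ⊗ q) (x ∷ w) + coeff (p ⊗ q) (x ∷ w)    ≈⟨ +-cong (coeff-const-⊗ a q (x ∷ w)) (coeff-⊗-∷ p q x w) ⟩
    a * cq + (coeff (∂ x p ⊗ q) w + coeff p [] * cq)          ≈⟨ x∙yz≈y∙xz _ _ _ ⟩
    coeff (∂ x p ⊗ q) w + (a * cq + coeff p [] * cq)          ≈⟨ +-cong refl (distribʳ _ a _) ⟨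
    coeff (∂ x p ⊗ q) w + (a + coeff p []) * cq               ∎
    where cq = coeff q (x ∷ w)
  coeff-⊗-∷ ((a , y ∷ u) ∷ p) q x w with y ≟v x
  ... | yes y≡x = begin
    coeff (((a , y ∷ u) ∷ p) ⊗ q) (x ∷ w)                        ≈⟨ coeff-∷-⊗ a (y ∷ u) p q (x ∷ w) ⟩
    coeff (monoP a (y ∷ u) ⊗ q) (x ∷ w) + coeff (p ⊗ q) (x ∷ w)  ≈⟨ +-cong (coeff-letter-⊗-≡ a y u q x w y≡x) (coeff-⊗-∷ p q x w) ⟩
    coeff (monoP a u ⊗ q) w + (coeff (∂ x p ⊗ q) w + cpq)        ≈⟨ +-assoc _ _ _ ⟨
    (coeff (monoP a u ⊗ q) w + coeff (∂ x p ⊗ q) w) + cpq        ≈⟨ +-cong (coeff-∷-⊗ a u (∂ x p) q w) refl ⟨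
    coeff (((a , u) ∷ ∂ x p) ⊗ q) w + cpq                        ∎
    where cpq = coeff p [] * coeff q (x ∷ w)
  ... | no y≢x = begin
    coeff (((a , y ∷ u) ∷ p) ⊗ q) (x ∷ w)                        ≈⟨ coeff-∷-⊗ a (y ∷ u) p q (x ∷ w) ⟩
    coeff (monoP a (y ∷ u) ⊗ q) (x ∷ w) + coeff (p ⊗ q) (x ∷ w)  ≈⟨ +-cong (coeff-letter-⊗-≢ a y u q x w y≢x) (coeff-⊗-∷ p q x w) ⟩
    0# + (coeff (∂ x p ⊗ q) w + coeff p [] * coeff q (x ∷ w))    ≈⟨ +-identityˡ _ ⟩
    coeff (∂ x p ⊗ q) w + coeff p [] * coeff q (x ∷ w)           ∎

  order-zero : ∀ p → OrderAtLeast 0 p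
  order-zero p w ()

  order-∂ : ∀ {k} x p → OrderAtLeast (suc k) p → OrderAtLeast k (∂ x p)
  order-∂ x p ord w lt = trans (coeff-∂ x p w) (ord (x ∷ w) (s≤s lt))

  order-⊗ : ∀ {a b} p q → OrderAtLeast a p → OrderAtLeast b q → OrderAtLeast (a ℕ.+ b) (p ⊗ q)
  order-⊗ {ℕ.zero} p q ordp ordq []      lt = begin
    coeff (p ⊗ q) []         ≈⟨ coeff-⊗-[] p q ⟩
    coeff p [] * coeff q []  ≈⟨ *-cong refl (ordq [] lt) ⟩
    coeff p [] * 0#          ≈⟨ zeroʳ _ ⟩
    0#                       ∎
  order-⊗ {suc a}  p q ordp ordq []      lt = begin
    coeff (p ⊗ q) []         ≈⟨ coeff-⊗-[] p q ⟩
    coeff p [] * coeff q []  ≈⟨ *-cong (ordp [] (s≤s z≤n)) refl ⟩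
    0# * coeff q []          ≈⟨ zeroˡ _ ⟩
    0#                       ∎
  order-⊗ {ℕ.zero} p q ordp ordq (x ∷ w) lt = begin
    coeff (p ⊗ q) (x ∷ w)                                 ≈⟨ coeff-⊗-∷ p q x w ⟩
    coeff (∂ x p ⊗ q) w + coeff p [] * coeff q (x ∷ w)    ≈⟨ +-cong (order-⊗ (∂ x p) q (order-zero (∂ x p)) ordq w (ℕₚ.<⇒≤ lt))
                                                                     (*-cong refl (ordq (x ∷ w) lt)) ⟩
    0# + coeff p [] * 0#                                  ≈⟨ trans (+-identityˡ _) (zeroʳ _) ⟩
    0#                                                    ∎
  order-⊗ {suc a}  p q ordp ordq (x ∷ w) (s≤s lt) = begin
    coeff (p ⊗ q) (x ∷ w)                                 ≈⟨ coeff-⊗-∷ p q x w ⟩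
    coeff (∂ x p ⊗ q) w + coeff p [] * coeff q (x ∷ w)    ≈⟨ +-cong (order-⊗ (∂ x p) q (order-∂ x p ordp) ordq w lt)
                                                                     (*-cong (ordp [] (s≤s z≤n)) refl) ⟩
    0# + 0# * coeff q (x ∷ w)                             ≈⟨ trans (+-identityˡ _) (zeroˡ _) ⟩
    0#                                                    ∎

  order-⊗ʳ : ∀ {a} p q → OrderAtLeast a p → OrderAtLeast a (p ⊗ q)
  order-⊗ʳ {a} p q ordp = order-weaken (p ⊗ q) (ℕₚ.m≤m+n a 0) (order-⊗ p q ordp (order-zero q))

  order-prodP : ∀ ps → All (OrderAtLeast 1) ps → OrderAtLeast (length ps) (prodP ps)
  order-prodP []       All.[]           w ()
  order-prodP (p ∷ ps) (ordp All.∷ ords) = order-⊗ p (prodP ps) ordp (order-prodP ps ords)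

  order-cong : ∀ {k} p q → p ≋ q → OrderAtLeast k q → OrderAtLeast k p
  order-cong p q p≋q ordq w lt = trans (p≋q w) (ordq w lt)

  order-xPart : ∀ p → OrderAtLeast 1 (xPart p)
  order-xPart []                 []      _ = refl
  order-xPart ((a , [])    ∷ p) []      _ = order-xPart p [] (s≤s z≤n)
  order-xPart ((a , v ∷ u) ∷ p) []      _ with isXVar v ∧ allX u
  ... | true  = order-xPart p [] (s≤s z≤n)
  ... | false = order-xPart p [] (s≤s z≤n)
  order-xPart p                  (_ ∷ _) (s≤s ())

  coeff-π-≡ : ∀ k p w → length w ≡ k → coeff (π k p) w ≈ coeff p w
  coeff-π-≡ k []            w ∣w∣≡k = refl
  coeff-π-≡ k ((a , u) ∷ p) w ∣w∣≡k with length u ℕ.≟ k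
  ... | yes _ with u ≟w w
  ...   | yes _   = +-cong refl (coeff-π-≡ k p w ∣w∣≡k)
  ...   | no  _   = coeff-π-≡ k p w ∣w∣≡k
  coeff-π-≡ k ((a , u) ∷ p) w ∣w∣≡k | no ∣u∣≢k with u ≟w w
  ...   | yes u≡w = ⊥-elim (∣u∣≢k (≡.trans (≡.cong length u≡w) ∣w∣≡k))
  ...   | no  _   = coeff-π-≡ k p w ∣w∣≡k

  coeff-π-≢ : ∀ k p w → ¬ length w ≡ k → coeff (π k p) w ≈ 0#
  coeff-π-≢ k []            w ∣w∣≢k = refl
  coeff-π-≢ k ((a , u) ∷ p) w ∣w∣≢k with length u ℕ.≟ k
  ... | no  _     = coeff-π-≢ k p w ∣w∣≢k
  ... | yes ∣u∣≡k with u ≟w w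
  ...   | yes u≡w = ⊥-elim (∣w∣≢k (≡.trans (≡.cong length (≡.sym u≡w)) ∣u∣≡k))
  ...   | no  _   = coeff-π-≢ k p w ∣w∣≢k

  π-order : ∀ k p → OrderAtLeast (suc k) p → π k p ≋ 𝟘
  π-order k p ord w with length w ℕ.≟ k
  ... | yes ∣w∣≡k = trans (coeff-π-≡ k p w ∣w∣≡k) (ord w (ℕₚ.≤-reflexive (≡.cong suc ∣w∣≡k)))
  ... | no  ∣w∣≢k = coeff-π-≢ k p w ∣w∣≢k

  order-InM : ∀ {m} {Ψ : Circuit m} {d} p → InM Ψ d p → OrderAtLeast 1 p
  order-InM p (_ , P , _ , _ , p≋P_X) = order-cong p (xPart P) p≋P_X (order-xPart P)

lemma9 : ∀ {c ℓ} (F : Field c ℓ) (n : ℕ) → let open NCPoly F n in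
    ∀ {m} (Ψ : Circuit (suc m)) → eval Ψ zero ≋ Pal →
    (ps : List (Poly × ℕ)) →
    All (λ pl → InM Ψ (proj₂ pl) (proj₁ pl)) ps →
    Linked _>_ (map proj₂ ps) →
    (q : Poly) → InQ Ψ q →
    length ps > n →
    π n (prodP (map proj₁ ps) ⊗ q) ≋ 𝟘
lemma9 F n Ψ _ ps ps∈M _ q _ r>n =
  π-order n (prodP qs ⊗ q)
    (order-weaken (prodP qs ⊗ q) r>n′ (order-⊗ʳ (prodP qs) q (order-prodP qs qs-order)))
  where
  open NCPoly F n
  open PolynomialOrder F n
  qs : List Poly
  qs = map proj₁ ps
  qs-order : All (OrderAtLeast 1) qs
  qs-order = All.map⁺ (All.map (λ {pl} → order-InM (proj₁ pl)) ps∈M)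
  r>n′ : length qs > n
  r>n′ = ≡.subst (_> n) (≡.sym (length-map proj₁ ps)) r>n
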